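{- Let $x,y$ be odd integers with $3\nmid x$, and let $w=x^2+3y^2$. Then there exist integers $u$ and $v$, both relatively prime to $6$, such that $w=u^2+3v^2$. -}

module Defs where

module Submission where

-- If 3 ∤ y we take (u, v) = (x, y).  Otherwise 3 ∣ y, and since x and y
-- are odd we may write x = 2h + y.  The form u² + 3v² admits the
-- "rotation" identity
--     (2v + y)² + 3y² = (v + 2y)² + 3v²,
-- and for x = 2v + y with v odd and 3 ∣ y the new pair (v + 2y, v) is
-- coprime to 6 (lemma rotate-to-coprime).  If h is odd we rotate with
-- v = h; if h is even we instead write x = 2(h + y) + (−y), where h + y
-- is odd, rotate that, and use that only y² enters the form.

open import Defs
open import Data.Integer using (ℤ; _+_; _*_; +_)
open import Data.Integer.Divisibility using (_∣_)
open import Data.Integer.Coprimality using (Coprime)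
open import Data.Product using (∃₂; _×_)
open import Relation.Nullary using (¬_)
open import Relation.Binary.PropositionalEquality using (_≡_)

open import Data.Integer using (_-_; -_; ∣_∣)
open import Data.Integer.Properties using (+-identityˡ; ∣-i∣≡∣i∣)
open import Data.Integer.DivMod using (_%_; _/_; n%d<d; a≡a%n+[a/n]*n)
import Data.Integer.Divisibility.Signed as Signed
open import Data.Integer.Tactic.RingSolver using (solve-∀)
import Data.Nat as ℕ
open import Data.Nat.Properties using (m+1+n≰m)
import Data.Nat.Divisibility as ℕ
open import Data.Product using (∃; _,_)
open import Data.Sum using (_⊎_; inj₁; inj₂)
open import Data.Empty using (⊥-elim)
open import Relation.Nullary using (yes; no; contradiction)
open import Relation.Nullary.Decidable using (from-no)
open import Relation.Binary.PropositionalEquality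
  using (refl; sym; trans; cong; subst; module ≡-Reasoning)
open ≡-Reasoning

CoprimeRepresentation : ℤ → ℤ → Set
CoprimeRepresentation x y = ∃₂ λ (u v : ℤ) → Coprime u (+ 6) × Coprime v (+ 6) ×
  (x * x + + 3 * (y * y) ≡ u * u + + 3 * (v * v))

divisors-of-6 : ∀ {d} → d ℕ.∣ 6 → d ≡ 1 ⊎ 2 ℕ.∣ d ⊎ 3 ℕ.∣ d
divisors-of-6 {0} 0∣6 = contradiction (ℕ.0∣⇒≡0 0∣6) λ ()
divisors-of-6 {1} _   = inj₁ refl
divisors-of-6 {2} _   = inj₂ (inj₁ ℕ.∣-refl)
divisors-of-6 {3} _   = inj₂ (inj₂ ℕ.∣-refl)
divisors-of-6 {4} 4∣6 = contradiction 4∣6 (from-no (4 ℕ.∣? 6))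
divisors-of-6 {5} 5∣6 = contradiction 5∣6 (from-no (5 ℕ.∣? 6))
divisors-of-6 {6} _   = inj₂ (inj₁ (ℕ.divides 3 refl))
divisors-of-6 {ℕ.suc (ℕ.suc (ℕ.suc (ℕ.suc (ℕ.suc (ℕ.suc (ℕ.suc d))))))} d∣6 =
  contradiction (ℕ.∣⇒≤ d∣6) (m+1+n≰m 6)

coprime-6 : ∀ u → ¬ + 2 ∣ u → ¬ + 3 ∣ u → Coprime u (+ 6)
coprime-6 u 2∤u 3∤u (d∣u , d∣6) with divisors-of-6 d∣6
... | inj₁ d≡1        = d≡1
... | inj₂ (inj₁ 2∣d) = ⊥-elim (2∤u (ℕ.∣-trans 2∣d d∣u))
... | inj₂ (inj₂ 3∣d) = ⊥-elim (3∤u (ℕ.∣-trans 3∣d d∣u))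

∤-combination : ∀ d k a b {x} → x ≡ k * a + b → d Signed.∣ b → ¬ d ∣ x → ¬ d ∣ a
∤-combination d k a b refl d∣b d∤x d∣a =
  d∤x (Signed.∣⇒∣ᵤ (Signed.∣m∣n⇒∣m+n (Signed.∣n⇒∣m*n k (Signed.∣ᵤ⇒∣ d∣a)) d∣b))

∣-neg : ∀ d y → d ∣ y → d ∣ - y
∣-neg d y = subst (∣ d ∣ ℕ.∣_) (sym (∣-i∣≡∣i∣ y))

odd-form : ∀ x → ¬ + 2 ∣ x → ∃ λ q → x ≡ + 1 + q * + 2
odd-form x 2∤x with x % + 2 | n%d<d x (+ 2) | a≡a%n+[a/n]*n x (+ 2)
... | 0 | _ | x≡2q = ⊥-elim (2∤x (Signed.∣⇒∣ᵤ
                       (Signed.divides (x / + 2) (trans x≡2q (+-identityˡ _)))))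
... | 1 | _ | x≡1+2q = x / + 2 , x≡1+2q
... | ℕ.suc (ℕ.suc _) | ℕ.s≤s (ℕ.s≤s ()) | _

odd-difference : ∀ x y → ¬ + 2 ∣ x → ¬ + 2 ∣ y → ∃ λ h → x ≡ + 2 * h + y
odd-difference x y 2∤x 2∤y with odd-form x 2∤x | odd-form y 2∤y
... | a , x≡1+2a | b , y≡1+2b = a - b , (begin
  x                                ≡⟨ x≡1+2a ⟩
  + 1 + a * + 2                    ≡⟨ shift a b ⟩
  + 2 * (a - b) + (+ 1 + b * + 2)  ≡⟨ cong (λ t → + 2 * (a - b) + t) (sym y≡1+2b) ⟩
  + 2 * (a - b) + y                ∎)
  where
  shift : ∀ a b → + 1 + a * + 2 ≡ + 2 * (a - b) + (+ 1 + b * + 2)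
  shift = solve-∀

rotation : ∀ v y → (+ 2 * v + y) * (+ 2 * v + y) + + 3 * (y * y)
                 ≡ (v + + 2 * y) * (v + + 2 * y) + + 3 * (v * v)
rotation = solve-∀

rotate-to-coprime : ∀ {x} v y → x ≡ + 2 * v + y → ¬ + 2 ∣ v → + 3 ∣ y → ¬ + 3 ∣ x →
  CoprimeRepresentation x y
rotate-to-coprime v y refl 2∤v 3∣y 3∤x =
  v + + 2 * y , v , coprime-6 (v + + 2 * y) 2∤u 3∤u , coprime-6 v 2∤v 3∤v , rotation v y
  where
  v-from-u : ∀ v y → v ≡ + 1 * (v + + 2 * y) + + 2 * (- y)
  v-from-u = solve-∀
  x-from-u : ∀ v y → + 2 * v + y ≡ + 2 * (v + + 2 * y) + - + 3 * y
  x-from-u = solve-∀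
  2∤u : ¬ + 2 ∣ v + + 2 * y
  2∤u = ∤-combination (+ 2) (+ 1) (v + + 2 * y) (+ 2 * (- y)) (v-from-u v y)
          (Signed.∣m⇒∣m*n (- y) Signed.∣-refl) 2∤v
  3∤u : ¬ + 3 ∣ v + + 2 * y
  3∤u = ∤-combination (+ 3) (+ 2) (v + + 2 * y) (- + 3 * y) (x-from-u v y)
          (Signed.∣n⇒∣m*n (- + 3) (Signed.∣ᵤ⇒∣ 3∣y)) 3∤x
  3∤v : ¬ + 3 ∣ v
  3∤v = ∤-combination (+ 3) (+ 2) v y refl (Signed.∣ᵤ⇒∣ 3∣y) 3∤x

-- Only y² enters the form, so the sign of y is irrelevant.
representation-neg : ∀ x y → CoprimeRepresentation x (- y) → CoprimeRepresentation x y
representation-neg x y (u , v , u⊥6 , v⊥6 , eq) = u , v , u⊥6 , v⊥6 , (begin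
  x * x + + 3 * (y * y)         ≡⟨ square-neg x y ⟩
  x * x + + 3 * (- y * - y)     ≡⟨ eq ⟩
  u * u + + 3 * (v * v)         ∎)
  where
  square-neg : ∀ x y → x * x + + 3 * (y * y) ≡ x * x + + 3 * (- y * - y)
  square-neg = solve-∀

rotate-with-odd-shift : ∀ x y h → x ≡ + 2 * h + y → ¬ + 2 ∣ y → + 3 ∣ y → ¬ + 3 ∣ x →
  CoprimeRepresentation x y
rotate-with-odd-shift x y h x≡2h+y 2∤y 3∣y 3∤x with 2 ℕ.∣? ∣ h ∣
... | no 2∤h = rotate-to-coprime h y x≡2h+y 2∤h 3∣y 3∤x
... | yes 2∣h = representation-neg x y
      (rotate-to-coprime (h + y) (- y) x≡2[h+y]-y 2∤h+y (∣-neg (+ 3) y 3∣y) 3∤x)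
  where
  regroup : ∀ h y → + 2 * h + y ≡ + 2 * (h + y) + - y
  regroup = solve-∀
  x≡2[h+y]-y : x ≡ + 2 * (h + y) + - y
  x≡2[h+y]-y = trans x≡2h+y (regroup h y)
  y-from-h+y : ∀ h y → y ≡ + 1 * (h + y) + - h
  y-from-h+y = solve-∀
  2∤h+y : ¬ + 2 ∣ h + y
  2∤h+y = ∤-combination (+ 2) (+ 1) (h + y) (- h) (y-from-h+y h y)
            (Signed.∣m⇒∣-m (Signed.∣ᵤ⇒∣ 2∣h)) 2∤y

lemma2p2 : (x y : ℤ) → ¬ (+ 2 ∣ x) → ¬ (+ 2 ∣ y) → ¬ (+ 3 ∣ x) →
    ∃₂ λ (u v : ℤ) → Coprime u (+ 6) × Coprime v (+ 6) ×
    (x * x + + 3 * (y * y) ≡ u * u + + 3 * (v * v))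
lemma2p2 x y 2∤x 2∤y 3∤x with 3 ℕ.∣? ∣ y ∣
... | no 3∤y = x , y , coprime-6 x 2∤x 3∤x , coprime-6 y 2∤y 3∤y , refl
... | yes 3∣y =
  let (h , x≡2h+y) = odd-difference x y 2∤x 2∤y
  in rotate-with-odd-shift x y h x≡2h+y 2∤y 3∣y 3∤x
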